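{- Let $G=(N,\{c\},R)$ with $N=\{\mathcal{B}_1,\dots,\mathcal{B}_m\}$ and $\mathcal{T}_G$ be as in the context. For every $i\in\{1,\dots,m\}$ and $n\in\mathbb{N}$: $\mathcal{T}_G\models A\sqsubseteq\bigcirc^nB_i$ if and only if $c^n\in L_G(\mathcal{B}_i)$.
   Context: TBoxes: finite sets of concept inclusions $A\sqsubseteq\bigcirc^nB$, $A\sqcap A'\sqsubseteq B$, $\exists r.A\sqsubseteq B$, $A\sqsubseteq\exists r.B$ with temporal semantics: an interpretation is a family $(\mathcal{I}_i)_{i\in\mathbb{Z}}$ of classical DL interpretations over a common domain, rigid role names interpreted identically at all $i$; $(\bigcirc^nA)^{i}=A^{i+n}$, $\sqcap$ is intersection, $(\exists r.A)^i=\{d\mid\exists e\in A^i,(d,e)\in r^i\}$; $C\sqsubseteq D$ holds if $C^i\subseteq D^i$ for all $i$; $\models$ is entailment over all models. Let $G=(N,\{c\},R)$ be a unary conjunctive grammar (semantics: $L_G(X)$ is the set of words $w$ with $X(w)$ derivable from the axiom $c(c)$ where each rule $\mathcal{N}\to\alpha_1\&\dots\&\alpha_n$ allows to infer $\mathcal{N}(w)$ from $X^i_j(u^i_j)$ whenever $\alpha_i=X^i_1\cdots X^i_{k_i}$ and $u^i_1\cdots u^i_{k_i}=w$ for every $i$) with $N=\{\mathcal{B}_1,\dots,\mathcal{B}_m\}$ and all rules of the forms $\mathcal{B}_i\to\varepsilon$, $\mathcal{B}_i\to c^n$ ($n>0$), $\mathcal{B}_i\to\alpha_1$, $\mathcal{B}_i\to\alpha_1\&\alpha_2$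 with $\alpha_1,\alpha_2$ nonempty strings of nonterminals. For $\alpha=\mathcal{B}_{i_1}\cdots\mathcal{B}_{i_k}$ let $\iota(\alpha)=i_1\dots i_k$. Let $\mathcal{J}$ be the set of all nonempty suffixes of sequences $\iota(\alpha)$ for strings $\alpha$ occurring in rules of $G$. Use concept names $A,B_1,\dots,B_m$, $C_\iota$ ($\iota\in\mathcal{J}$), and rigid role names $r_\iota$ ($\iota\in\mathcal{J}$ of length $\ge2$); $i\iota$ denotes $\iota$ with $i$ prepended. $\mathcal{T}_G$ consists exactly of: $A\sqsubseteq B_i$ for each rule $\mathcal{B}_i\to\varepsilon$; $A\sqsubseteq\bigcirc^nB_i$ for each rule $\mathcal{B}_i\to c^n$; $C_{\iota(\alpha_1)}\sqsubseteq B_i$ for each rule $\mathcal{B}_i\to\alpha_1$; $C_{\iota(\alpha_1)}\sqcap C_{\iota(\alpha_2)}\sqsubseteq B_i$ for each rule $\mathcal{B}_i\to\alpha_1\&\alpha_2$; $B_i\sqsubseteq\exists r_{i\iota}.A$ for each $i\iota\in\mathcal{J}$ with $\iota$ nonempty; $\exists r_{i\iota}.C_\iota\sqsubseteq C_{i\iota}$ for all $\iota,i\iota\in\mathcal{J}$; $B_i\sqsubseteq C_i$ for each $i$ whose one-element sequence is in $\mathcal{J}$. -}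

module Defs where

open import Data.Nat using (ℕ; zero; suc; _+_; NonZero)
open import Data.Integer as ℤ using (ℤ; +_)
open import Data.Fin using (Fin)
open import Data.List using (List; []; _∷_; _++_; concatMap)
open import Data.List.NonEmpty as List⁺ using (List⁺; _∷_; toList)
open import Data.List.Membership.Propositional using (_∈_)
open import Data.List.Relation.Unary.All using (All)
open import Data.Product using (Σ; _×_)

-- Unary conjunctive grammars G = (N, {c}, R) with N = {B_1..B_m},
-- nonterminals indexed by Fin m; the word c^n is identified with n.

data Rule (m : ℕ) : Set where
  eps    : Fin m → Rule m
  term   : (i : Fin m) (n : ℕ) → NonZero n → Rule m
  single : Fin m → List⁺ (Fin m) → Rule m
  conj   : Fin m → List⁺ (Fin m) → List⁺ (Fin m) → Rule m

Grammar : ℕ → Set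
Grammar m = List (Rule m)

mutual
  data Derives {m : ℕ} (R : Grammar m) : Fin m → ℕ → Set where
    d-eps    : ∀ {i} → eps i ∈ R → Derives R i 0
    d-term   : ∀ {i n p} → term i n p ∈ R → Derives R i n
    d-single : ∀ {i α n} → single i α ∈ R → DerivesStr R (toList α) n → Derives R i n
    d-conj   : ∀ {i α β n} → conj i α β ∈ R →
               DerivesStr R (toList α) n → DerivesStr R (toList β) n → Derives R i n

  data DerivesStr {m : ℕ} (R : Grammar m) : List (Fin m) → ℕ → Set where
    s-nil  : DerivesStr R [] 0
    s-cons : ∀ {X xs n₁ n₂} → Derives R X n₁ → DerivesStr R xs n₂ →
             DerivesStr R (X ∷ xs) (n₁ + n₂)

InLang : {m : ℕ} → Grammar m → Fin m → ℕ → Set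
InLang R i n = Derives R i n

data CName (m : ℕ) : Set where
  cA : CName m
  cB : Fin m → CName m
  cC : List⁺ (Fin m) → CName m

RName : ℕ → Set
RName m = List⁺ (Fin m)

data Concept (m : ℕ) : Set where
  atom : CName m → Concept m
  nxt  : ℕ → Concept m → Concept m
  _⊓_  : Concept m → Concept m → Concept m
  ex   : RName m → Concept m → Concept m

record CI (m : ℕ) : Set where
  constructor _⊑_
  field
    lhs rhs : Concept m

TBox : ℕ → Set
TBox m = List (CI m)

-- A temporal interpretation: a family (I_i)_{i ∈ ℤ} over a common domain Δ;
-- role names are rigid, hence not time-indexed.
record Interp (m : ℕ) (Δ : Set) : Set₁ where
  field
    conc : CName m → ℤ → Δ → Set
    role : RName m → Δ → Δ → Set

ext : ∀ {m Δ} → Interp m Δ → Concept m → ℤ → Δ → Set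
ext I (atom a)  i d = Interp.conc I a i d
ext I (nxt n C) i d = ext I C (i ℤ.+ + n) d
ext I (C ⊓ D)   i d = ext I C i d × ext I D i d
ext I (ex r C)  i d = Σ _ λ e → Interp.role I r d e × ext I C i e

Sat : ∀ {m Δ} → Interp m Δ → CI m → Set
Sat I (C ⊑ D) = ∀ i d → ext I C i d → ext I D i d

Model : ∀ {m Δ} → Interp m Δ → TBox m → Set
Model I T = All (Sat I) T

_⊨_ : ∀ {m} → TBox m → CI m → Set₁
T ⊨ ci = ∀ (Δ : Set) (I : Interp _ Δ) → Model I T → Sat I ci

strings : ∀ {m} → Rule m → List (List⁺ (Fin m))
strings (eps _)        = []
strings (term _ _ _)   = []
strings (single _ α)   = α ∷ []
strings (conj _ α β)   = α ∷ β ∷ []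

sufs : ∀ {A : Set} → A → List A → List (List⁺ A)
sufs x []       = (x ∷ []) ∷ []
sufs x (y ∷ ys) = (x ∷ y ∷ ys) ∷ sufs y ys

suffixes : ∀ {A : Set} → List⁺ A → List (List⁺ A)
suffixes (x ∷ xs) = sufs x xs

-- the set 𝒥 (as a list, possibly with repetitions)
𝒥 : ∀ {m} → Grammar m → List (List⁺ (Fin m))
𝒥 R = concatMap (λ r → concatMap suffixes (strings r)) R

A' : ∀ {m} → Concept m
A' = atom cA

ruleAxioms : ∀ {m} → Rule m → TBox m
ruleAxioms (eps i)        = (A' ⊑ atom (cB i)) ∷ []
ruleAxioms (term i n _)   = (A' ⊑ nxt n (atom (cB i))) ∷ []
ruleAxioms (single i α)   = (atom (cC α) ⊑ atom (cB i)) ∷ []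
ruleAxioms (conj i α β)   = ((atom (cC α) ⊓ atom (cC β)) ⊑ atom (cB i)) ∷ []

jAxioms : ∀ {m} → List⁺ (Fin m) → TBox m
jAxioms (i ∷ [])     = (atom (cB i) ⊑ atom (cC (i ∷ []))) ∷ []
jAxioms (i ∷ k ∷ ks) =
  (atom (cB i) ⊑ ex (i ∷ k ∷ ks) A') ∷
  (ex (i ∷ k ∷ ks) (atom (cC (k ∷ ks))) ⊑ atom (cC (i ∷ k ∷ ks))) ∷ []

𝒯 : ∀ {m} → Grammar m → TBox m
𝒯 R = concatMap ruleAxioms R ++ concatMap jAxioms (𝒥 R)

-- Soundness: every axiom of 𝒯_G is a rule of G read through time, so a derivation
-- of c^n ∈ L(B_i) becomes a chain of inclusions from A to ○ⁿB_i; the only subtle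
-- case is a string B_i ι, where the axiom B_i ⊑ ∃r_{iι}.A starts a fresh copy of A
-- at the moment B_i is reached, and rigidity of r_{iι} lets C_ι be carried back.
-- Completeness: a canonical model over the domain ℤ, in which d satisfies A exactly
-- at time d and satisfies B_i (resp. C_α) at time d + k exactly when c^k ∈ L(B_i)
-- (resp. c^k ∈ L(α)), and r_{iι} links d to d + k whenever c^k ∈ L(B_i); it refutes
-- every inclusion A ⊑ ○ⁿB_i with c^n ∉ L(B_i).
module Submission where

open import Defs
open import Data.Nat using (ℕ)
open import Data.Fin using (Fin)
open import Function.Bundles using (_⇔_)

open import Algebra.Bundles using (AbelianGroup)
import Algebra.Properties.Group as GroupProperties
import Data.Nat as ℕ
import Data.Nat.Properties as ℕ
open import Data.Integer as ℤ using (ℤ; +_)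
import Data.Integer.Properties as ℤ
open import Data.List using (List; []; _∷_; concatMap)
open import Data.List.NonEmpty using (List⁺; _∷_; toList)
open import Data.List.Membership.Propositional using (_∈_; lose)
open import Data.List.Membership.Propositional.Properties
  using (∈-++⁺ˡ; ∈-++⁺ʳ; ∈-concatMap⁺; ∈-concatMap⁻)
open import Data.List.Relation.Unary.All as All using (All)
import Data.List.Relation.Unary.All.Properties as All
import Data.List.Relation.Unary.Any as Any
open import Data.List.Relation.Unary.Any using (here; there)
open import Data.Product using (Σ; _×_; _,_)
open import Function using (_∘_)
open import Function.Bundles using (mk⇔)
open import Relation.Binary.PropositionalEquality using (_≡_; refl; sym; trans; cong; subst)

open GroupProperties (AbelianGroup.group ℤ.+-0-abelianGroup) using (∙-cancelˡ)

+-assoc-pos : ∀ t m n → (t ℤ.+ + m) ℤ.+ + n ≡ t ℤ.+ + (m ℕ.+ n)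
+-assoc-pos t m n = trans (ℤ.+-assoc t (+ m) (+ n)) (cong (λ u → t ℤ.+ u) (sym (ℤ.pos-+ m n)))

sufs-self : ∀ {A : Set} (x : A) xs → (x ∷ xs) ∈ sufs x xs
sufs-self x []      = here refl
sufs-self x (_ ∷ _) = here refl

sufs-tail : ∀ {A : Set} (x : A) xs {a b bs} → (a ∷ b ∷ bs) ∈ sufs x xs → (b ∷ bs) ∈ sufs x xs
sufs-tail x []       (here ())
sufs-tail x []       (there ())
sufs-tail x (y ∷ ys) (here refl) = there (sufs-self y ys)
sufs-tail x (y ∷ ys) (there p)   = there (sufs-tail y ys p)

suffixes-tail : ∀ {A : Set} (s : List⁺ A) {a b bs} → (a ∷ b ∷ bs) ∈ suffixes s → (b ∷ bs) ∈ suffixes s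
suffixes-tail (x ∷ xs) = sufs-tail x xs

module _ {m} {R : Grammar m} where

  stringSuffixes : Rule m → List (List⁺ (Fin m))
  stringSuffixes r = concatMap suffixes (strings r)

  string∈𝒥 : ∀ {r x xs} → r ∈ R → (x ∷ xs) ∈ strings r → (x ∷ xs) ∈ 𝒥 R
  string∈𝒥 {x = x} {xs} r∈ α∈ =
    ∈-concatMap⁺ stringSuffixes (lose r∈ (∈-concatMap⁺ suffixes (lose α∈ (sufs-self x xs))))

  𝒥-tail : ∀ {a b bs} → (a ∷ b ∷ bs) ∈ 𝒥 R → (b ∷ bs) ∈ 𝒥 R
  𝒥-tail =
    ∈-concatMap⁺ stringSuffixes ∘ Any.map (λ {r} → tail∈ {r = r}) ∘ ∈-concatMap⁻ stringSuffixes {R}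
    where
    tail∈ : ∀ {a b bs r} → (a ∷ b ∷ bs) ∈ stringSuffixes r → (b ∷ bs) ∈ stringSuffixes r
    tail∈ {r = r} =
      ∈-concatMap⁺ suffixes ∘ Any.map (λ {s} → suffixes-tail s) ∘ ∈-concatMap⁻ suffixes {strings r}

  ruleAxiom∈𝒯 : ∀ {r ci} → r ∈ R → ci ∈ ruleAxioms r → ci ∈ 𝒯 R
  ruleAxiom∈𝒯 r∈ ci∈ = ∈-++⁺ˡ (∈-concatMap⁺ ruleAxioms (lose r∈ ci∈))

  jAxiom∈𝒯 : ∀ {j ci} → j ∈ 𝒥 R → ci ∈ jAxioms j → ci ∈ 𝒯 R
  jAxiom∈𝒯 j∈ ci∈ = ∈-++⁺ʳ (concatMap ruleAxioms R) (∈-concatMap⁺ jAxioms (lose j∈ ci∈))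

module Soundness {m} (R : Grammar m) {Δ : Set} (I : Interp m Δ) (M : Model I (𝒯 R)) where
  open Interp I

  rule-valid : ∀ {r ci} → r ∈ R → ci ∈ ruleAxioms r → Sat I ci
  rule-valid r∈ = All.lookup M ∘ ruleAxiom∈𝒯 r∈

  j-valid : ∀ {j ci} → j ∈ 𝒥 R → ci ∈ jAxioms j → Sat I ci
  j-valid j∈ = All.lookup M ∘ jAxiom∈𝒯 {R = R} j∈

  mutual
    derives-sound : ∀ {i n} → Derives R i n → Sat I (A' ⊑ nxt n (atom (cB i)))
    derives-sound (d-eps r∈) t d a =
      subst (λ u → conc (cB _) u d) (sym (ℤ.+-identityʳ t)) (rule-valid r∈ (here refl) t d a)
    derives-sound (d-term r∈) = rule-valid r∈ (here refl)
    derives-sound (d-single {α = _ ∷ _} r∈ D) t d a =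
      rule-valid r∈ (here refl) _ d (string-sound (string∈𝒥 r∈ (here refl)) D t d a)
    derives-sound (d-conj {α = _ ∷ _} {β = _ ∷ _} r∈ D₁ D₂) t d a =
      rule-valid r∈ (here refl) _ d
        ( string-sound (string∈𝒥 r∈ (here refl)) D₁ t d a
        , string-sound (string∈𝒥 r∈ (there (here refl))) D₂ t d a )

    string-sound : ∀ {x xs n} → (x ∷ xs) ∈ 𝒥 R → DerivesStr R (x ∷ xs) n →
                   Sat I (A' ⊑ nxt n (atom (cC (x ∷ xs))))
    string-sound {x} {[]} j∈ (s-cons {n₁ = n₁} D s-nil) t d a =
      subst (λ k → conc (cC (x ∷ [])) (t ℤ.+ + k) d) (sym (ℕ.+-identityʳ n₁))
        (j-valid j∈ (here refl) _ d (derives-sound D t d a))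
    string-sound {x} {_ ∷ _} j∈ (s-cons {n₁ = n₁} {n₂} D S) t d a
      with j-valid j∈ (here refl) _ d (derives-sound D t d a)
    ... | e , r-de , a-e =
      subst (λ u → conc (cC (x ∷ _)) u d) (+-assoc-pos t n₁ n₂)
        (j-valid j∈ (there (here refl)) _ d (e , r-de , string-sound (𝒥-tail {R = R} j∈) S _ e a-e))

derives⇒entails : ∀ {m} (R : Grammar m) {i n} → Derives R i n → 𝒯 R ⊨ (A' ⊑ nxt n (atom (cB i)))
derives⇒entails R D Δ I M = Soundness.derives-sound R I M D

Offset : (ℕ → Set) → ℤ → ℤ → Set
Offset P t d = Σ ℕ λ k → t ≡ d ℤ.+ + k × P k

offset-unique : ∀ {t d k₁ k₂} → t ≡ d ℤ.+ + k₁ → t ≡ d ℤ.+ + k₂ → k₁ ≡ k₂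
offset-unique {d = d} e₁ e₂ = ℤ.+-injective (∙-cancelˡ d _ _ (trans (sym e₁) e₂))

module Canonical {m} (R : Grammar m) where

  conc : CName m → ℤ → ℤ → Set
  conc cA     t d = t ≡ d
  conc (cB i) t d = Offset (Derives R i) t d
  conc (cC α) t d = Offset (DerivesStr R (toList α)) t d

  role : RName m → ℤ → ℤ → Set
  role (i ∷ _) d e = Offset (Derives R i) e d

  I : Interp m ℤ
  I = record { conc = conc ; role = role }

  rule-axioms-valid : ∀ {r} → r ∈ R → All (Sat I) (ruleAxioms r)
  rule-axioms-valid {eps i} r∈ =
    (λ t d t≡d → 0 , trans t≡d (sym (ℤ.+-identityʳ d)) , d-eps r∈) All.∷ All.[]
  rule-axioms-valid {term i n _} r∈ =
    (λ t d t≡d → n , cong (λ u → u ℤ.+ + n) t≡d , d-term r∈) All.∷ All.[]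
  rule-axioms-valid {single i α} r∈ =
    (λ { t d (k , t≡ , D) → k , t≡ , d-single r∈ D }) All.∷ All.[]
  rule-axioms-valid {conj i α β} r∈ =
    (λ { t d ((k , t≡ , D₁) , (k′ , t≡′ , D₂)) →
         k , t≡ , d-conj r∈ D₁ (subst (DerivesStr R (toList β)) (offset-unique {d = d} t≡′ t≡) D₂) })
    All.∷ All.[]

  j-axioms-valid : ∀ j → All (Sat I) (jAxioms j)
  j-axioms-valid (i ∷ []) =
    (λ { t d (k , t≡ , D) →
         k , t≡ , subst (DerivesStr R (i ∷ [])) (ℕ.+-identityʳ k) (s-cons D s-nil) })
    All.∷ All.[]
  j-axioms-valid (i ∷ _ ∷ _) =
    (λ { t d B-td → t , B-td , refl })
    All.∷ (λ { t d (e , (k₁ , e≡ , D) , (k₂ , t≡ , S)) →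
               k₁ ℕ.+ k₂ , trans t≡ (trans (cong (λ u → u ℤ.+ + k₂) e≡) (+-assoc-pos d k₁ k₂))
                         , s-cons D S })
    All.∷ All.[]

  model : Model I (𝒯 R)
  model = All.++⁺ (All.concat⁺ (All.map⁺ (All.tabulate rule-axioms-valid)))
                  (All.concat⁺ (All.map⁺ (All.universal j-axioms-valid (𝒥 R))))

entails⇒derives : ∀ {m} (R : Grammar m) {i n} → 𝒯 R ⊨ (A' ⊑ nxt n (atom (cB i))) → Derives R i n
entails⇒derives R {i} ⊨A⊑○ⁿBᵢ with ⊨A⊑○ⁿBᵢ ℤ (Canonical.I R) (Canonical.model R) (+ 0) (+ 0) refl
... | k , n≡k , D = subst (Derives R i) (sym (offset-unique {d = + 0} refl n≡k)) D

lemma3 : (m : ℕ) (R : Grammar m) (i : Fin m) (n : ℕ) →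
    (𝒯 R ⊨ (atom cA ⊑ nxt n (atom (cB i)))) ⇔ InLang R i n
lemma3 m R i n = mk⇔ (entails⇒derives R) (derives⇒entails R)
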